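{- Let $\mathsf{tr}'$ be any (correct) translation from mental programs to BDDs, i.e. a map assigning to each mental program $\pi$ over a finite ordered vocabulary $V$ a BDD $\mathsf{tr}'(\pi)$ over $V\cup V'$ such that for all $s,t\subseteq V$, $s\xrightarrow{\pi}t$ iff $s\cup t'\vDash\mathsf{tr}'(\pi)$. Then there exist mental programs $\pi$ such that the size of $\mathsf{tr}'(\pi)$ is exponential in $|\pi|$: there are vocabularies $V_n$ and mental programs $\pi_n$ over $V_n$ ($n\ge1$) with $|\pi_n|\to\infty$ and a constant $c>0$ such that $\mathsf{tr}'(\pi_n)$ has at least $2^{c|\pi_n|}$ nodes.
   Context: Mental programs over a finite vocabulary $V$: $\pi::=p\leftarrow\top\mid p\leftarrow\bot\mid\beta?\mid\pi\cup\pi\mid\pi;\pi\mid\pi\cap\pi$ ($p\in V$, $\beta$ a Boolean formula over $V$, built from $\top,\bot$, atoms, $\neg,\land$). Length: $|p\leftarrow\top|=|p\leftarrow\bot|=1$, $|\beta?|=|\beta|$ (formula length: atoms and constants 1, each connective adds 1), $|\pi_1\cup\pi_2|=|\pi_1;\pi_2|=|\pi_1\cap\pi_2|=|\pi_1|+|\pi_2|$. Semantics for $s,t\subseteq V$: $s\xrightarrow{p\leftarrow\top}t$ iff $t=s\cup\{p\}$; $s\xrightarrow{p\leftarrow\bot}t$ iff $t=s\setminus\{p\}$; $s\xrightarrow{\beta?}t$ iff $s=t$ and $s\vDash\beta$; $\cup,\cap$ are union and intersection of relations; $;$ is relational composition. $V'=\{p'\mid p\in V\}$ is a fresh copy, $t'=\{p'\mid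 p\in t\}$. If $V$ is ordered $p_1<p_2<\dots<p_m$, BDDs over $V\cup V'$ are reduced ordered binary decision diagrams with respect to the interleaved order $p_1<p_1'<p_2<p_2'<\dots<p_m<p_m'$; the size of a BDD is its number of nodes. -}

module Defs where

open import Data.Nat using (ℕ; zero; suc; _+_; _*_; _≤_)
open import Data.Bool using (Bool; true; false; if_then_else_; not; _∧_; T)
import Data.Bool.Properties as BoolP
open import Data.Fin using (Fin; toℕ)
import Data.Fin.Properties as FinP
open import Data.Vec using (Vec; lookup; _[_]≔_)
open import Data.List using (List; []; _∷_; _++_; length; deduplicate)
open import Data.Product using (Σ; _×_; _,_)
open import Data.Sum using (_⊎_)
open import Data.Unit using (⊤)
open import Relation.Binary.PropositionalEquality using (_≡_; _≢_; refl; cong)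
open import Relation.Nullary using (Dec; yes; no)

-- Vocabulary V = {p_0 < p_1 < ... < p_{m-1}} is represented by Fin m
-- (natural order).  A state s ⊆ V is its characteristic vector.

State : ℕ → Set
State m = Vec Bool m

data Form (m : ℕ) : Set where
  ⊤ᶠ  : Form m
  ⊥ᶠ  : Form m
  atom : Fin m → Form m
  ¬ᶠ_  : Form m → Form m
  _∧ᶠ_ : Form m → Form m → Form m

flen : ∀ {m} → Form m → ℕ
flen ⊤ᶠ = 1
flen ⊥ᶠ = 1
flen (atom _) = 1
flen (¬ᶠ β) = suc (flen β)
flen (β ∧ᶠ γ) = suc (flen β + flen γ)

sat : ∀ {m} → State m → Form m → Bool
sat s ⊤ᶠ = true
sat s ⊥ᶠ = false
sat s (atom p) = lookup s p
sat s (¬ᶠ β) = not (sat s β)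
sat s (β ∧ᶠ γ) = sat s β ∧ sat s γ

data Prog (m : ℕ) : Set where
  _←⊤  : Fin m → Prog m
  _←⊥  : Fin m → Prog m
  _¿   : Form m → Prog m
  _∪ₚ_ : Prog m → Prog m → Prog m
  _⨾_  : Prog m → Prog m → Prog m
  _∩ₚ_ : Prog m → Prog m → Prog m

∣_∣ₚ : ∀ {m} → Prog m → ℕ
∣ p ←⊤ ∣ₚ = 1
∣ p ←⊥ ∣ₚ = 1
∣ β ¿ ∣ₚ = flen β
∣ π₁ ∪ₚ π₂ ∣ₚ = ∣ π₁ ∣ₚ + ∣ π₂ ∣ₚ
∣ π₁ ⨾ π₂ ∣ₚ = ∣ π₁ ∣ₚ + ∣ π₂ ∣ₚ
∣ π₁ ∩ₚ π₂ ∣ₚ = ∣ π₁ ∣ₚ + ∣ π₂ ∣ₚ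

⟦_⟧ : ∀ {m} → Prog m → State m → State m → Set
⟦ p ←⊤ ⟧ s t = t ≡ s [ p ]≔ true
⟦ p ←⊥ ⟧ s t = t ≡ s [ p ]≔ false
⟦ β ¿ ⟧ s t = (s ≡ t) × T (sat s β)
⟦ π₁ ∪ₚ π₂ ⟧ s t = ⟦ π₁ ⟧ s t ⊎ ⟦ π₂ ⟧ s t
⟦ π₁ ⨾ π₂ ⟧ s t = Σ (State _) λ u → ⟦ π₁ ⟧ s u × ⟦ π₂ ⟧ u t
⟦ π₁ ∩ₚ π₂ ⟧ s t = ⟦ π₁ ⟧ s t × ⟦ π₂ ⟧ s t

-- A decision variable is a pair (p , primed?):
-- (p , false) stands for p, (p , true) stands for p'.
-- A BDD is given as a term; equal sub-terms denote the same (shared)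
-- node, so the nodes of the DAG are the distinct sub-terms.

data BDD (m : ℕ) : Set where
  leaf : Bool → BDD m
  -- node p primed? low high : test the variable; low = else-edge, high = then-edge
  node : Fin m → Bool → BDD m → BDD m → BDD m

-- position of a variable in the interleaved order p_1 < p_1' < p_2 < p_2' < ...
rank : ∀ {m} → Fin m → Bool → ℕ
rank p false = 2 * toℕ p
rank p true  = suc (2 * toℕ p)

evalBDD : ∀ {m} → BDD m → State m → State m → Bool
evalBDD (leaf b) s t = b
evalBDD (node p false lo hi) s t = if lookup s p then evalBDD hi s t else evalBDD lo s t
evalBDD (node p true  lo hi) s t = if lookup t p then evalBDD hi s t else evalBDD lo s t

OrderedFrom : ∀ {m} → ℕ → BDD m → Set
OrderedFrom r (leaf _) = ⊤
OrderedFrom r (node p x lo hi) =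
  (r ≤ rank p x) × OrderedFrom (suc (rank p x)) lo × OrderedFrom (suc (rank p x)) hi

Ordered : ∀ {m} → BDD m → Set
Ordered = OrderedFrom 0

-- no redundant tests (low and high successors distinct); isomorphic
-- sub-graphs are identified automatically by the term representation
NoRedundant : ∀ {m} → BDD m → Set
NoRedundant (leaf _) = ⊤
NoRedundant (node p x lo hi) = (lo ≢ hi) × NoRedundant lo × NoRedundant hi

IsROBDD : ∀ {m} → BDD m → Set
IsROBDD B = Ordered B × NoRedundant B

_≟ᴮ_ : ∀ {m} (a b : BDD m) → Dec (a ≡ b)
leaf a ≟ᴮ leaf b with a BoolP.≟ b
... | yes refl = yes refl
... | no ne = no λ { refl → ne refl }
leaf _ ≟ᴮ node _ _ _ _ = no λ ()
node _ _ _ _ ≟ᴮ leaf _ = no λ ()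
node p x l h ≟ᴮ node q y l' h' with p FinP.≟ q | x BoolP.≟ y | l ≟ᴮ l' | h ≟ᴮ h'
... | yes refl | yes refl | yes refl | yes refl = yes refl
... | no ne | _ | _ | _ = no λ { refl → ne refl }
... | yes _ | no ne | _ | _ = no λ { refl → ne refl }
... | yes _ | yes _ | no ne | _ = no λ { refl → ne refl }
... | yes _ | yes _ | yes _ | no ne = no λ { refl → ne refl }

subterms : ∀ {m} → BDD m → List (BDD m)
subterms (leaf b) = leaf b ∷ []
subterms (node p x lo hi) = node p x lo hi ∷ (subterms lo ++ subterms hi)

size : ∀ {m} → BDD m → ℕ
size B = length (deduplicate _≟ᴮ_ (subterms B))

-- Take the vocabulary p₁ … p_k, q₁ … q_k and the test π_k = (⋀ᵢ pᵢ ↔ qᵢ)?, of length 12k + 1.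
-- In the interleaved order every pᵢ, pᵢ' comes before every qⱼ, qⱼ'. For a valuation a of the
-- p's, run an ordered BDD for π_k on the state that gives a to both the p's and the q's (and to
-- their primed copies) until it first meets a q-variable. Distinct valuations arrive at distinct
-- nodes: if a and b arrive at the same node, the state "p := a, q := b" follows the path of
-- "p := a, q := a" down to that node and the path of "p := b, q := b" from there on, so it is
-- accepted and a = b. Hence the BDD has at least 2^k nodes.
module Submission where

open import Defs
open import Data.Nat using (ℕ; zero; suc; _≤_; _<_; _^_; _+_; _*_; z≤n; s≤s; s≤s⁻¹)
open import Data.Nat.Properties
open import Data.Bool using (Bool; true; false; T; if_then_else_)
open import Data.Bool.Properties using (T-∧)
open import Data.Product using (Σ; _×_; _,_; proj₁)
open import Function using (_∘_; const; _⇔_; mk⇔; Injective; Equivalence; Injection)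
open import Function.Properties.Inverse using (↔⇒↣)
open import Data.Fin using (Fin; toℕ; _↑ˡ_; _↑ʳ_; finToFun; funToFin; combine)
open import Data.Fin.Properties using (2↔Bool; injective⇒≤; funToFin-finToFin)
open import Data.Vec using (Vec; lookup; tabulate; _++_)
open import Data.Vec.Properties using (lookup-++ˡ; lookup-++ʳ; lookup-++-<; lookup-++-≥; lookup∘tabulate; tabulate∘lookup; tabulate-cong)
open import Data.List using (List; []; _∷_; length; allFin)
import Data.List as List
open import Data.List.Properties using (length-tabulate)
open import Data.List.Membership.Propositional using (_∈_)
open import Data.List.Membership.Propositional.Properties using (∈-++⁺ˡ; ∈-++⁺ʳ; ∈-deduplicate⁺; ∈-allFin)
open import Data.List.Relation.Unary.Any using (here; there; index)
open import Data.List.Relation.Unary.Any.Properties using (lookup-index)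
open import Data.List.Relation.Unary.All as All using (All; []; _∷_)
open import Data.Unit using (tt)
open import Relation.Nullary using (yes; no)
open import Relation.Binary.PropositionalEquality

private
  variable
    m n k : ℕ

open Equivalence

≤-length-of-injection : ∀ {A : Set} {f : Fin n → A} {xs : List A}
  → Injective _≡_ _≡_ f → (∀ i → f i ∈ xs) → n ≤ length xs
≤-length-of-injection {f = f} {xs} f-inj f∈xs = injective⇒≤ index-inj
  where
  index-inj : Injective _≡_ _≡_ (index ∘ f∈xs)
  index-inj {i} {j} eq = f-inj (begin
    f i                               ≡⟨ lookup-index (f∈xs i) ⟩
    List.lookup xs (index (f∈xs i))   ≡⟨ cong (List.lookup xs) eq ⟩
    List.lookup xs (index (f∈xs j))   ≡⟨ lookup-index (f∈xs j) ⟨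
    f j                               ∎)
    where open ≡-Reasoning

funToFin-cong : ∀ {f g : Fin m → Fin n} → (∀ i → f i ≡ g i) → funToFin f ≡ funToFin g
funToFin-cong {zero}  _ = refl
funToFin-cong {suc m} f≗g = cong₂ combine (f≗g Fin.zero) (funToFin-cong (f≗g ∘ Fin.suc))
  where import Data.Fin as Fin

vec-ext : {a b : Vec Bool n} → (∀ i → lookup a i ≡ lookup b i) → a ≡ b
vec-ext {a = a} {b} a≗b = trans (sym (tabulate∘lookup a)) (trans (tabulate-cong a≗b) (tabulate∘lookup b))

bits : Fin (2 ^ n) → Vec Bool n
bits i = tabulate (Injection.to (↔⇒↣ 2↔Bool) ∘ finToFun i)

bits-injective : Injective _≡_ _≡_ (bits {n})
bits-injective {n} {i} {j} eq = begin
  i                                ≡⟨ funToFin-finToFin {n} {2} i ⟨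
  funToFin (finToFun {2} {n} i)    ≡⟨ funToFin-cong same-digits ⟩
  funToFin (finToFun {2} {n} j)    ≡⟨ funToFin-finToFin {n} {2} j ⟩
  j                                ∎
  where
  open ≡-Reasoning
  same-digits : ∀ l → finToFun i l ≡ finToFun j l
  same-digits l = Injection.injective (↔⇒↣ 2↔Bool) (begin
    _                 ≡⟨ lookup∘tabulate _ l ⟨
    lookup (bits i) l ≡⟨ cong (λ v → lookup v l) eq ⟩
    lookup (bits j) l ≡⟨ lookup∘tabulate _ l ⟩
    _                 ∎)

2^≤length-of-injection : ∀ {A : Set} {f : Vec Bool n → A} {xs : List A}
  → Injective _≡_ _≡_ f → (∀ a → f a ∈ xs) → 2 ^ n ≤ length xs
2^≤length-of-injection f-inj f∈xs = ≤-length-of-injection (bits-injective ∘ f-inj) (f∈xs ∘ bits)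

value : State m → State m → Fin m → Bool → Bool
value s t p false = lookup s p
value s t p true  = lookup t p

Agree : (ℕ → Set) → State m → State m → State m → State m → Set
Agree R s t s′ t′ = ∀ p x → R (rank p x) → value s t p x ≡ value s′ t′ p x

evalBDD-node : ∀ p x (lo hi : BDD m) s t
  → evalBDD (node p x lo hi) s t ≡ (if value s t p x then evalBDD hi s t else evalBDD lo s t)
evalBDD-node p false lo hi s t = refl
evalBDD-node p true  lo hi s t = refl

cut : ℕ → BDD m → State m → State m → BDD m
cut r (leaf b) s t = leaf b
cut r (node p x lo hi) s t with r ≤? rank p x
... | yes _ = node p x lo hi
... | no  _ = if value s t p x then cut r hi s t else cut r lo s t

cut-∈-subterms : ∀ r (B : BDD m) s t → cut r B s t ∈ subterms B
cut-∈-subterms r (leaf b) s t = here refl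
cut-∈-subterms r (node p x lo hi) s t with r ≤? rank p x
... | yes _ = here refl
... | no  _ with value s t p x
...   | true  = there (∈-++⁺ʳ (subterms lo) (cut-∈-subterms r hi s t))
...   | false = there (∈-++⁺ˡ (cut-∈-subterms r lo s t))

evalBDD-cut : ∀ r (B : BDD m) s t → evalBDD (cut r B s t) s t ≡ evalBDD B s t
evalBDD-cut r (leaf b) s t = refl
evalBDD-cut r (node p x lo hi) s t with r ≤? rank p x
... | yes _ = refl
... | no  _ rewrite evalBDD-node p x lo hi s t with value s t p x
...   | true  = evalBDD-cut r hi s t
...   | false = evalBDD-cut r lo s t

cut-ordered : ∀ r {l} (B : BDD m) s t → OrderedFrom l B → OrderedFrom r (cut r B s t)
cut-ordered r (leaf b) s t _ = tt
cut-ordered r (node p x lo hi) s t (_ , lo-ord , hi-ord) with r ≤? rank p x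
... | yes r≤ = r≤ , lo-ord , hi-ord
... | no  _ with value s t p x
...   | true  = cut-ordered r hi s t hi-ord
...   | false = cut-ordered r lo s t lo-ord

cut-cong : ∀ r (B : BDD m) {s t s′ t′} → Agree (_< r) s t s′ t′ → cut r B s t ≡ cut r B s′ t′
cut-cong r (leaf b) _ = refl
cut-cong r (node p x lo hi) {s′ = s′} {t′} agree with r ≤? rank p x
... | yes _ = refl
... | no r≰ rewrite agree p x (≰⇒> r≰) with value s′ t′ p x
...   | true  = cut-cong r hi agree
...   | false = cut-cong r lo agree

evalBDD-cong : ∀ {r} (B : BDD m) {s t s′ t′}
  → OrderedFrom r B → Agree (r ≤_) s t s′ t′ → evalBDD B s t ≡ evalBDD B s′ t′
evalBDD-cong (leaf b) _ _ = refl
evalBDD-cong (node p x lo hi) {s} {t} {s′} {t′} (r≤ , lo-ord , hi-ord) agree = begin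
  evalBDD (node p x lo hi) s t
    ≡⟨ evalBDD-node p x lo hi s t ⟩
  (if value s t p x then evalBDD hi s t else evalBDD lo s t)
    ≡⟨ cong (λ b → if b then evalBDD hi s t else evalBDD lo s t) (agree p x r≤) ⟩
  (if value s′ t′ p x then evalBDD hi s t else evalBDD lo s t)
    ≡⟨ cong₂ (if value s′ t′ p x then_else_) (evalBDD-cong hi hi-ord agree′) (evalBDD-cong lo lo-ord agree′) ⟩
  (if value s′ t′ p x then evalBDD hi s′ t′ else evalBDD lo s′ t′)
    ≡⟨ evalBDD-node p x lo hi s′ t′ ⟨
  evalBDD (node p x lo hi) s′ t′ ∎
  where
  open ≡-Reasoning
  agree′ : Agree (suc (rank p x) ≤_) s t s′ t′
  agree′ q y lt = agree q y (≤-trans r≤ (<⇒≤ lt))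

evalBDD-crossover : ∀ r {B : BDD m} {s t s₁ t₁ s₂ t₂} → Ordered B
  → Agree (_< r) s t s₁ t₁ → Agree (r ≤_) s t s₂ t₂
  → cut r B s₁ t₁ ≡ cut r B s₂ t₂ → evalBDD B s t ≡ evalBDD B s₂ t₂
evalBDD-crossover r {B} {s} {t} {s₂ = s₂} {t₂} ord below above same-cut = begin
  evalBDD B s t                   ≡⟨ evalBDD-cut r B s t ⟨
  evalBDD (cut r B s t) s t       ≡⟨ cong (λ N → evalBDD N s t) (trans (cut-cong r B below) same-cut) ⟩
  evalBDD (cut r B s₂ t₂) s t     ≡⟨ evalBDD-cong (cut r B s₂ t₂) (cut-ordered r B s₂ t₂ ord) above ⟩
  evalBDD (cut r B s₂ t₂) s₂ t₂   ≡⟨ evalBDD-cut r B s₂ t₂ ⟩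
  evalBDD B s₂ t₂                 ∎
  where open ≡-Reasoning

2*toℕ≤rank : ∀ (p : Fin m) x → 2 * toℕ p ≤ rank p x
2*toℕ≤rank p false = ≤-refl
2*toℕ≤rank p true  = n≤1+n _

rank<2*suc-toℕ : ∀ (p : Fin m) x → rank p x < 2 * suc (toℕ p)
rank<2*suc-toℕ p false = *-monoʳ-< 2 (n<1+n (toℕ p))
rank<2*suc-toℕ p true  = subst (rank p true <_) (sym (*-suc 2 (toℕ p))) ≤-refl

rank<2*⇒toℕ< : ∀ (p : Fin m) x → rank p x < 2 * k → toℕ p < k
rank<2*⇒toℕ< p x lt = *-cancelˡ-< 2 _ _ (≤-<-trans (2*toℕ≤rank p x) lt)

2*≤rank⇒≤toℕ : ∀ (p : Fin m) x → 2 * k ≤ rank p x → k ≤ toℕ p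
2*≤rank⇒≤toℕ p x le = s≤s⁻¹ (*-cancelˡ-< 2 _ _ (≤-<-trans le (rank<2*suc-toℕ p x)))

agree-diagonal : ∀ {R : ℕ → Set} {s s′ : State m}
  → (∀ p x → R (rank p x) → lookup s p ≡ lookup s′ p) → Agree R s s s′ s′
agree-diagonal same p false = same p false
agree-diagonal same p true  = same p true

agree-below-halves : (a b b′ : Vec Bool k) → Agree (_< 2 * k) (a ++ b) (a ++ b) (a ++ b′) (a ++ b′)
agree-below-halves {k} a b b′ = agree-diagonal {R = _< 2 * k} λ p x lt →
  let p<k = rank<2*⇒toℕ< p x lt in trans (lookup-++-< a b p p<k) (sym (lookup-++-< a b′ p p<k))

agree-above-halves : (a a′ b : Vec Bool k) → Agree (2 * k ≤_) (a ++ b) (a ++ b) (a′ ++ b) (a′ ++ b)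
agree-above-halves {k} a a′ b = agree-diagonal {R = 2 * k ≤_} λ p x le →
  let k≤p = 2*≤rank⇒≤toℕ p x le in trans (lookup-++-≥ a b p k≤p) (sym (lookup-++-≥ a′ b p k≤p))

_⇔ᶠ_ : Form m → Form m → Form m
β ⇔ᶠ γ = (¬ᶠ (β ∧ᶠ (¬ᶠ γ))) ∧ᶠ (¬ᶠ ((¬ᶠ β) ∧ᶠ γ))

sat-⇔ᶠ : ∀ s (β γ : Form m) → T (sat s (β ⇔ᶠ γ)) ⇔ (sat s β ≡ sat s γ)
sat-⇔ᶠ s β γ with sat s β | sat s γ
... | true  | true  = mk⇔ (const refl) (const tt)
... | false | false = mk⇔ (const refl) (const tt)
... | true  | false = mk⇔ (λ ()) (λ ())
... | false | true  = mk⇔ (λ ()) (λ ())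

halvesAgreeᶠ : List (Fin k) → Form (k + k)
halvesAgreeᶠ [] = ⊤ᶠ
halvesAgreeᶠ {k} (i ∷ is) = (atom (i ↑ˡ k) ⇔ᶠ atom (k ↑ʳ i)) ∧ᶠ halvesAgreeᶠ is

flen-halvesAgreeᶠ : (is : List (Fin k)) → flen (halvesAgreeᶠ is) ≡ suc (12 * length is)
flen-halvesAgreeᶠ [] = refl
flen-halvesAgreeᶠ (i ∷ is) = cong suc (begin
  11 + flen (halvesAgreeᶠ is)    ≡⟨ cong (11 +_) (flen-halvesAgreeᶠ is) ⟩
  11 + suc (12 * length is)      ≡⟨ +-suc 11 (12 * length is) ⟩
  12 + 12 * length is            ≡⟨ *-suc 12 (length is) ⟨
  12 * suc (length is)           ∎)
  where open ≡-Reasoning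

sat-halvesAgreeᶠ : (a b : Vec Bool k) (is : List (Fin k))
  → T (sat (a ++ b) (halvesAgreeᶠ is)) ⇔ All (λ i → lookup a i ≡ lookup b i) is
sat-halvesAgreeᶠ a b [] = mk⇔ (const []) (const tt)
sat-halvesAgreeᶠ {k} a b (i ∷ is) = mk⇔
  (λ h → let h₁ , h₂ = to T-∧ h in to head h₁ ∷ to tail h₂)
  (λ { (e ∷ es) → from T-∧ (from head e , from tail es) })
  where
  head : T (sat (a ++ b) (atom (i ↑ˡ k) ⇔ᶠ atom (k ↑ʳ i))) ⇔ (lookup a i ≡ lookup b i)
  head = subst₂ (λ x y → T (sat (a ++ b) (atom (i ↑ˡ k) ⇔ᶠ atom (k ↑ʳ i))) ⇔ (x ≡ y))
    (lookup-++ˡ a b i) (lookup-++ʳ a b i) (sat-⇔ᶠ (a ++ b) (atom (i ↑ˡ k)) (atom (k ↑ʳ i)))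
  tail = sat-halvesAgreeᶠ a b is

halvesEqual : (k : ℕ) → Prog (k + k)
halvesEqual k = halvesAgreeᶠ (allFin k) ¿

∣halvesEqual∣ : ∀ k → ∣ halvesEqual k ∣ₚ ≡ suc (12 * k)
∣halvesEqual∣ k = trans (flen-halvesAgreeᶠ (allFin k)) (cong (suc ∘ (12 *_)) (length-tabulate {n = k} (λ i → i)))

halvesEqual-accepts : (a : Vec Bool k) → ⟦ halvesEqual k ⟧ (a ++ a) (a ++ a)
halvesEqual-accepts {k} a = refl , from (sat-halvesAgreeᶠ a a (allFin k)) (All.tabulate (const refl))

halvesEqual-only-accepts-equal : {a b : Vec Bool k} → ⟦ halvesEqual k ⟧ (a ++ b) (a ++ b) → a ≡ b
halvesEqual-only-accepts-equal {k} {a} {b} (_ , h) =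
  vec-ext (λ i → All.lookup (to (sat-halvesAgreeᶠ a b (allFin k)) h) (∈-allFin i))

halvesEqual-size : ∀ {k} {B : BDD (k + k)} → Ordered B
  → (∀ s t → ⟦ halvesEqual k ⟧ s t ⇔ T (evalBDD B s t)) → 2 ^ k ≤ size B
halvesEqual-size {k} {B} ordered correct =
  2^≤length-of-injection cut-injective (λ a → ∈-deduplicate⁺ _≟ᴮ_ (cut-∈-subterms (2 * k) B _ _))
  where
  cutAt : Vec Bool k → BDD (k + k)
  cutAt a = cut (2 * k) B (a ++ a) (a ++ a)

  accepts : (a b : Vec Bool k) → T (evalBDD B (a ++ b) (a ++ b)) ⇔ (a ≡ b)
  accepts a b = mk⇔ (halvesEqual-only-accepts-equal ∘ from (correct _ _))
    (λ { refl → to (correct _ _) (halvesEqual-accepts a) })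

  cut-injective : Injective _≡_ _≡_ cutAt
  cut-injective {a} {b} same-cut = to (accepts a b) (subst T (sym crossed) (from (accepts b b) refl))
    where
    crossed : evalBDD B (a ++ b) (a ++ b) ≡ evalBDD B (b ++ b) (b ++ b)
    crossed = evalBDD-crossover (2 * k) ordered (agree-below-halves a b a) (agree-above-halves a b b) same-cut

2^[1+12k]≤[2^k]^13 : ∀ k → 1 ≤ k → 2 ^ suc (12 * k) ≤ (2 ^ k) ^ 13
2^[1+12k]≤[2^k]^13 k 1≤k = begin
  2 ^ suc (12 * k)   ≤⟨ ^-monoʳ-≤ 2 (+-monoˡ-≤ (12 * k) 1≤k) ⟩
  2 ^ (13 * k)       ≡⟨ cong (2 ^_) (*-comm 13 k) ⟩
  2 ^ (k * 13)       ≡⟨ ^-*-assoc 2 k 13 ⟨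
  (2 ^ k) ^ 13       ∎
  where open ≤-Reasoning

theorem13 : (tr : (m : ℕ) → Prog m → BDD m)
    → ((m : ℕ) (π : Prog m) → IsROBDD (tr m π))
    → ((m : ℕ) (π : Prog m) (s t : State m) → (⟦ π ⟧ s t ⇔ T (evalBDD (tr m π) s t)))
    → Σ ℕ λ d → Σ (ℕ → ℕ) λ V → Σ ((n : ℕ) → Prog (V n)) λ π
        → ((N : ℕ) → Σ ℕ λ n₀ → (n : ℕ) → n₀ ≤ n → N ≤ ∣ π n ∣ₚ)
        × ((n : ℕ) → 2 ^ ∣ π n ∣ₚ ≤ size (tr (V n) (π n)) ^ suc d)
theorem13 tr robdd correct = 12 , V , π , unbounded , exponential
  where
  V : ℕ → ℕ
  V n = suc n + suc n

  π : (n : ℕ) → Prog (V n)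
  π n = halvesEqual (suc n)

  unbounded : (N : ℕ) → Σ ℕ λ n₀ → (n : ℕ) → n₀ ≤ n → N ≤ ∣ π n ∣ₚ
  unbounded N = N , λ n N≤n → subst (N ≤_) (sym (∣halvesEqual∣ (suc n)))
    (≤-trans N≤n (≤-trans (n≤1+n n) (m≤n⇒m≤1+n (m≤m+n (suc n) (11 * suc n)))))

  exponential : (n : ℕ) → 2 ^ ∣ π n ∣ₚ ≤ size (tr (V n) (π n)) ^ 13
  exponential n = subst (λ l → 2 ^ l ≤ size (tr (V n) (π n)) ^ 13) (sym (∣halvesEqual∣ (suc n)))
    (≤-trans (2^[1+12k]≤[2^k]^13 (suc n) (s≤s z≤n))
      (^-monoˡ-≤ 13 (halvesEqual-size {suc n} (proj₁ (robdd _ (π n))) (correct _ (π n)))))
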